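{- The maps $C:\mathcal{M}^{\mathrm{CP}}_{\mathbb{Z}}\to\mathbb{Z}_{\leq 4}$ and $C:\widehat{\mathcal{S}}^{\mathrm{CP}}\to\mathbb{Z}_{\leq 4}$ are surjective.
   Context: $\mathcal{M}$ is the set of real $2\times 3$ arrays $M=\begin{pmatrix} x & y & z\\ x' & y' & z'\end{pmatrix}$ with $xyz=x'y'z'$ and each column's two entries of the same sign (encoding the skew-symmetrizable matrix $\begin{pmatrix}0&-z'&y\\ z&0&-x'\\ -y'&x&0\end{pmatrix}$). The transformations are $\gamma_1(M)=\begin{pmatrix} y'z'-x & y & z\\ yz-x' & y' & z'\end{pmatrix}$, $\gamma_2(M)=\begin{pmatrix} x & z'x'-y & z\\ x' & zx-y' & z'\end{pmatrix}$, $\gamma_3(M)=\begin{pmatrix} x & y & x'y'-z\\ x' & y' & xy-z'\end{pmatrix}$, and on triples $S=(p,q,r)\in\mathbb{R}^3$: $\gamma_1(p,q,r)=(qr-p,q,r)$, $\gamma_2(p,q,r)=(p,rp-q,r)$, $\gamma_3(p,q,r)=(p,q,pq-r)$. $\Gamma(M)$ (resp. $\Gamma(S)$) is the set of all images under finite compositions of the $\gamma_k$ with consecutive indices distinct; a positive element is cluster-positive if every element of its orbit has all entries positive. $\mathcal{M}^{\mathrm{CP}}_{\mathbb{Z}}$ is the set of cluster-positive elements of $\mathcal{M}$ with integer entries. $\mathrm{Sk}(M)=(\varepsilon_x\sqrt{xx'},\varepsilon_y\sqrt{yy'},\varepsilon_z\sqrt{zz'})$, where $\varepsilon_a$ is the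 sign of $a$, and $\widehat{\mathcal{S}}^{\mathrm{CP}}=\mathrm{Sk}(\mathcal{M}^{\mathrm{CP}}_{\mathbb{Z}})$. The Markov constants are $C(M)=xx'+yy'+zz'-xyz$ and $C(p,q,r)=p^2+q^2+r^2-pqr$. -}

module Defs where

open import Data.Integer using (ℤ; +_; _+_; _-_; _*_; _<_; _≤_)
open import Data.Fin using (Fin; zero; suc)
open import Data.List using (List; []; _∷_)
open import Data.Product using (_×_; ∃)
open import Data.Sum using (_⊎_)
open import Data.Unit using (⊤)
open import Relation.Binary.PropositionalEquality using (_≡_; _≢_)

record Arr : Set where
  constructor arr
  field
    x y z x' y' z' : ℤ
open Arr public

SameSign : ℤ → ℤ → Set
SameSign a b = (+ 0 < a × + 0 < b) ⊎ (a ≡ + 0 × b ≡ + 0) ⊎ (a < + 0 × b < + 0)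

InM : Arr → Set
InM M = (x M * y M * z M ≡ x' M * y' M * z' M)
      × SameSign (x M) (x' M) × SameSign (y M) (y' M) × SameSign (z M) (z' M)

-- the mutations γ₁ γ₂ γ₃ (indexed by Fin 3 = {0,1,2})
γ : Fin 3 → Arr → Arr
γ zero (arr x y z x' y' z') = arr (y' * z' - x) y z (y * z - x') y' z'
γ (suc zero) (arr x y z x' y' z') = arr x (z' * x' - y) z x' (z * x - y') z'
γ (suc (suc zero)) (arr x y z x' y' z') = arr x y (x' * y' - z) x' y' (x * y - z')

applyWord : List (Fin 3) → Arr → Arr
applyWord [] M = M
applyWord (k ∷ ks) M = applyWord ks (γ k M)

NoRepeat : List (Fin 3) → Set
NoRepeat [] = ⊤
NoRepeat (k ∷ []) = ⊤
NoRepeat (k ∷ l ∷ ks) = (k ≢ l) × NoRepeat (l ∷ ks)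

InOrbit : Arr → Arr → Set
InOrbit M N = ∃ λ (ks : List (Fin 3)) → NoRepeat ks × applyWord ks M ≡ N

Positive : Arr → Set
Positive M = (+ 0 < x M) × (+ 0 < y M) × (+ 0 < z M)
           × (+ 0 < x' M) × (+ 0 < y' M) × (+ 0 < z' M)

ClusterPositive : Arr → Set
ClusterPositive M = Positive M × (∀ N → InOrbit M N → Positive N)

-- M ∈ 𝓜^CP_ℤ  (integrality is built into Arr)
InMCPZ : Arr → Set
InMCPZ M = InM M × ClusterPositive M

CM : Arr → ℤ
CM M = x M * x' M + y M * y' M + z M * z' M - x M * y M * z M

-- Sk(M) = (p,q,r) with p = ε_x √(xx'), etc.  Then p² = xx', q² = yy', r² = zz',
-- and pqr = t is the number with t² = xx'·yy'·zz' and the sign of ε_x ε_y ε_z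
-- (= sign of xyz).  "C(Sk M) = c" i.e. p²+q²+r²-pqr = c is stated through this t.
SkMarkov : Arr → ℤ → Set
SkMarkov M c = ∃ λ (t : ℤ) →
    (t * t ≡ (x M * x' M) * (y M * y' M) * (z M * z' M))
  × SameSign t (x M * y M * z M)
  × (x M * x' M + y M * y' M + z M * z' M - t ≡ c)

{-# OPTIONS --safe #-}
-- Take M = (1 m 3 / m 1 3) with m = 9 − c ≥ 5; then C(M) = 9 − m = c.  Arrays of the
-- shape (a mb c / ma b c) are preserved by the γ_k, which act on (a, b, c) as the mutations
-- a ↦ bc − a, b ↦ ca − b, c ↦ mab − c.  Compare the coordinates through the heights
-- 2a, 2b, c: if all heights are ≥ 2 and k is the tallest index, then mutating at any j ≠ k
-- makes j taller than k was (this needs m ≥ 4), so along a word without repetitions the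
-- heights stay ≥ 2 and every entry stays positive.  Finally, on 𝓜 one has
-- (xyz)² = xx'·yy'·zz', so the product pqr of Sk(M) equals xyz and C(Sk M) = C(M).
module Submission where

open import Defs
open import Data.Integer using (ℤ; +_; _≤_)
open import Data.Product using (_×_; ∃)
open import Relation.Binary.PropositionalEquality using (_≡_)

open import Data.Nat as ℕ using (z≤n)
open import Data.Integer using (0ℤ; _+_; _-_; _*_; _<_; +≤+; +<+)
open import Data.Integer.Properties
  using (≤-refl; <⇒≤; ≤-trans; <-≤-trans; <-cmp; +-mono-≤; pos-*; i≤j⇒0≤j-i;
         0≤i-j⇒j≤i; *-cancelˡ-≤-pos; suc[i]≤j⇒i<j; module ≤-Reasoning)
open import Data.Integer.Tactic.RingSolver using (solve-∀)
open import Data.Fin using (Fin; _≟_)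
open import Data.Fin.Patterns using (0F; 1F; 2F)
open import Data.List using (List; []; _∷_)
open import Data.Product using (_,_; proj₁)
open import Data.Sum using (inj₁; inj₂)
open import Data.Empty using (⊥-elim)
open import Relation.Binary.Definitions using (tri<; tri≈; tri>)
open import Relation.Binary.PropositionalEquality
  using (_≢_; refl; sym; cong; subst; ≢-sym; module ≡-Reasoning)
open import Relation.Nullary using (yes; no)
open import Function using (_∘_)

*-nonNeg : ∀ {i j} → 0ℤ ≤ i → 0ℤ ≤ j → 0ℤ ≤ i * j
*-nonNeg {+ m} {+ n} _ _ = subst (0ℤ ≤_) (pos-* m n) (+≤+ z≤n)

*-pos : ∀ {i j} → 0ℤ < i → 0ℤ < j → 0ℤ < i * j
*-pos {+ ℕ.suc m} {+ ℕ.suc n} _ _ = +<+ ℕ.z<s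
*-pos {+ 0} (+<+ ())
*-pos {+ ℕ.suc _} {+ 0} _ (+<+ ())

≤-by-certificate : ∀ {i j d} → j - i ≡ d → 0ℤ ≤ d → i ≤ j
≤-by-certificate j-i≡d 0≤d = 0≤i-j⇒j≤i (subst (0ℤ ≤_) (sym j-i≡d) 0≤d)

nonNeg-of-2≤ : ∀ {i} → + 2 ≤ i → 0ℤ ≤ i
nonNeg-of-2≤ = ≤-trans (+≤+ z≤n)

pos-of-2≤ : ∀ {i} → + 2 ≤ i → 0ℤ < i
pos-of-2≤ = <-≤-trans (+<+ ℕ.z<s)

pos-of-2≤2* : ∀ {i} → + 2 ≤ + 2 * i → 0ℤ < i
pos-of-2≤2* {i} 2≤2i = suc[i]≤j⇒i<j (*-cancelˡ-≤-pos (+ 1) i (+ 2) 2≤2i)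

nonNeg-of-2≤2* : ∀ {i} → + 2 ≤ + 2 * i → 0ℤ ≤ i
nonNeg-of-2≤2* = <⇒≤ ∘ pos-of-2≤2*

Triple : Set
Triple = ℤ × ℤ × ℤ

embed : ℤ → Triple → Arr
embed m (a , b , c) = arr a (m * b) c (m * a) b c

mutate : ℤ → Fin 3 → Triple → Triple
mutate m 0F (a , b , c) = (b * c - a , b , c)
mutate m 1F (a , b , c) = (a , c * a - b , c)
mutate m 2F (a , b , c) = (a , b , m * a * b - c)

mutateWord : ℤ → List (Fin 3) → Triple → Triple
mutateWord m []       t = t
mutateWord m (k ∷ ks) t = mutateWord m ks (mutate m k t)

γ-embed : ∀ m k t → γ k (embed m t) ≡ embed m (mutate m k t)
γ-embed m 0F (a , b , c) = cong (λ u → arr (b * c - a) (m * b) c u b c) (identity m a b c)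
  where
  identity : ∀ m a b c → m * b * c - m * a ≡ m * (b * c - a)
  identity = solve-∀
γ-embed m 1F (a , b , c) = cong (λ u → arr a u c (m * a) (c * a - b) c) (identity m a b c)
  where
  identity : ∀ m a b c → c * (m * a) - m * b ≡ m * (c * a - b)
  identity = solve-∀
γ-embed m 2F (a , b , c) =
  cong (λ u → arr a (m * b) (m * a * b - c) (m * a) b u) (identity m a b c)
  where
  identity : ∀ m a b c → a * (m * b) - c ≡ m * a * b - c
  identity = solve-∀

applyWord-embed : ∀ m ks t → applyWord ks (embed m t) ≡ embed m (mutateWord m ks t)
applyWord-embed m []       t = refl
applyWord-embed m (k ∷ ks) t rewrite γ-embed m k t = applyWord-embed m ks (mutate m k t)

height : Fin 3 → Triple → ℤ
height 0F (a , b , c) = + 2 * a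
height 1F (a , b , c) = + 2 * b
height 2F (a , b , c) = c

height-mutate-≢ : ∀ {m i j} t → i ≢ j → height i (mutate m j t) ≡ height i t
height-mutate-≢ {i = 0F} {0F} t i≢j = ⊥-elim (i≢j refl)
height-mutate-≢ {i = 0F} {1F} t _   = refl
height-mutate-≢ {i = 0F} {2F} t _   = refl
height-mutate-≢ {i = 1F} {0F} t _   = refl
height-mutate-≢ {i = 1F} {1F} t i≢j = ⊥-elim (i≢j refl)
height-mutate-≢ {i = 1F} {2F} t _   = refl
height-mutate-≢ {i = 2F} {0F} t _   = refl
height-mutate-≢ {i = 2F} {1F} t _   = refl
height-mutate-≢ {i = 2F} {2F} t i≢j = ⊥-elim (i≢j refl)

Large : Triple → Set
Large t = ∀ i → + 2 ≤ height i t

Tallest : Fin 3 → Triple → Set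
Tallest k t = ∀ i → height i t ≤ height k t

0≤2 : 0ℤ ≤ + 2
0≤2 = +≤+ z≤n

mutate-overtakes : ∀ {m} k j t → + 4 ≤ m → Large t → Tallest k t → k ≢ j
                 → height k t ≤ height j (mutate m j t)
mutate-overtakes 0F 0F _ _ _ _ k≢j = ⊥-elim (k≢j refl)
mutate-overtakes 1F 1F _ _ _ _ k≢j = ⊥-elim (k≢j refl)
mutate-overtakes 2F 2F _ _ _ _ k≢j = ⊥-elim (k≢j refl)
mutate-overtakes 0F 1F (a , b , c) _ large tallest _ =
  ≤-by-certificate (certificate a b c)
    (+-mono-≤ (*-nonNeg 0≤2 (*-nonNeg (i≤j⇒0≤j-i (large 2F)) (nonNeg-of-2≤2* (large 0F))))
              (i≤j⇒0≤j-i (tallest 1F)))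
  where
  certificate : ∀ a b c → + 2 * (c * a - b) - + 2 * a
                        ≡ + 2 * ((c - + 2) * a) + (+ 2 * a - + 2 * b)
  certificate = solve-∀
mutate-overtakes 1F 0F (a , b , c) _ large tallest _ =
  ≤-by-certificate (certificate a b c)
    (+-mono-≤ (*-nonNeg 0≤2 (*-nonNeg (i≤j⇒0≤j-i (large 2F)) (nonNeg-of-2≤2* (large 1F))))
              (i≤j⇒0≤j-i (tallest 0F)))
  where
  certificate : ∀ a b c → + 2 * (b * c - a) - + 2 * b
                        ≡ + 2 * ((c - + 2) * b) + (+ 2 * b - + 2 * a)
  certificate = solve-∀
mutate-overtakes {m} 0F 2F (a , b , c) 4≤m large tallest _ =
  ≤-by-certificate (certificate m a b c)
    (+-mono-≤ (+-mono-≤ (*-nonNeg (*-nonNeg (i≤j⇒0≤j-i 4≤m) (nonNeg-of-2≤2* (large 0F)))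
                                  (nonNeg-of-2≤2* (large 1F)))
                        (*-nonNeg (*-nonNeg 0≤2 (nonNeg-of-2≤2* (large 0F)))
                                  (i≤j⇒0≤j-i (large 1F))))
              (i≤j⇒0≤j-i (tallest 2F)))
  where
  certificate : ∀ m a b c → m * a * b - c - + 2 * a
              ≡ (m - + 4) * a * b + + 2 * a * (+ 2 * b - + 2) + (+ 2 * a - c)
  certificate = solve-∀
mutate-overtakes {m} 1F 2F (a , b , c) 4≤m large tallest _ =
  ≤-by-certificate (certificate m a b c)
    (+-mono-≤ (+-mono-≤ (*-nonNeg (*-nonNeg (i≤j⇒0≤j-i 4≤m) (nonNeg-of-2≤2* (large 0F)))
                                  (nonNeg-of-2≤2* (large 1F)))
                        (*-nonNeg (*-nonNeg 0≤2 (nonNeg-of-2≤2* (large 1F)))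
                                  (i≤j⇒0≤j-i (large 0F))))
              (i≤j⇒0≤j-i (tallest 2F)))
  where
  certificate : ∀ m a b c → m * a * b - c - + 2 * b
              ≡ (m - + 4) * a * b + + 2 * b * (+ 2 * a - + 2) + (+ 2 * b - c)
  certificate = solve-∀
mutate-overtakes 2F 0F (a , b , c) _ large tallest _ =
  ≤-by-certificate (certificate a b c)
    (+-mono-≤ (*-nonNeg (i≤j⇒0≤j-i (large 1F)) (nonNeg-of-2≤ (large 2F)))
              (i≤j⇒0≤j-i (tallest 0F)))
  where
  certificate : ∀ a b c → + 2 * (b * c - a) - c ≡ (+ 2 * b - + 2) * c + (c - + 2 * a)
  certificate = solve-∀
mutate-overtakes 2F 1F (a , b , c) _ large tallest _ =
  ≤-by-certificate (certificate a b c)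
    (+-mono-≤ (*-nonNeg (i≤j⇒0≤j-i (large 0F)) (nonNeg-of-2≤ (large 2F)))
              (i≤j⇒0≤j-i (tallest 1F)))
  where
  certificate : ∀ a b c → + 2 * (c * a - b) - c ≡ (+ 2 * a - + 2) * c + (c - + 2 * b)
  certificate = solve-∀

mutate-large : ∀ {m k j} t → + 4 ≤ m → Large t → Tallest k t → k ≢ j
             → Large (mutate m j t)
mutate-large {k = k} {j} t 4≤m large tallest k≢j i with i ≟ j
... | yes refl = ≤-trans (large k) (mutate-overtakes k j t 4≤m large tallest k≢j)
... | no i≢j   = subst (+ 2 ≤_) (sym (height-mutate-≢ t i≢j)) (large i)

mutate-tallest : ∀ {m k j} t → + 4 ≤ m → Large t → Tallest k t → k ≢ j
               → Tallest j (mutate m j t)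
mutate-tallest {m} {k} {j} t 4≤m large tallest k≢j i with i ≟ j
... | yes refl = ≤-refl
... | no i≢j   = begin
  height i (mutate m j t) ≡⟨ height-mutate-≢ t i≢j ⟩
  height i t              ≤⟨ tallest i ⟩
  height k t              ≤⟨ mutate-overtakes k j t 4≤m large tallest k≢j ⟩
  height j (mutate m j t) ∎
  where open ≤-Reasoning

mutateWord-large : ∀ {m k} ks t → + 4 ≤ m → Large t → Tallest k t → NoRepeat (k ∷ ks)
                 → Large (mutateWord m ks t)
mutateWord-large []       t _   large _       _                = large
mutateWord-large (j ∷ ks) t 4≤m large tallest (k≢j , noRepeat) =
  mutateWord-large ks _ 4≤m (mutate-large t 4≤m large tallest k≢j)
                            (mutate-tallest t 4≤m large tallest k≢j) noRepeat

embed-positive : ∀ {m} t → + 4 ≤ m → Large t → Positive (embed m t)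
embed-positive {m} (a , b , c) 4≤m large =
  0<a , *-pos 0<m 0<b , 0<c , *-pos 0<m 0<a , 0<b , 0<c
  where
  0<a : 0ℤ < a
  0<a = pos-of-2≤2* (large 0F)
  0<b : 0ℤ < b
  0<b = pos-of-2≤2* (large 1F)
  0<c : 0ℤ < c
  0<c = pos-of-2≤ (large 2F)
  0<m : 0ℤ < m
  0<m = <-≤-trans (+<+ ℕ.z<s) 4≤m

embed-clusterPositive : ∀ {m k} t → + 4 ≤ m
                      → Large t → Tallest k t → Large (mutate m k t) → Tallest k (mutate m k t)
                      → ClusterPositive (embed m t)
embed-clusterPositive {m} {k} t 4≤m large tallest large′ tallest′ =
  embed-positive t 4≤m large , orbit-positive
  where
  reduced-large : ∀ ks → NoRepeat ks → Large (mutateWord m ks t)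
  reduced-large []       _        = large
  reduced-large (j ∷ ks) noRepeat with j ≟ k
  ... | yes refl = mutateWord-large ks (mutate m k t) 4≤m large′ tallest′ noRepeat
  ... | no j≢k   = mutateWord-large (j ∷ ks) t 4≤m large tallest (≢-sym j≢k , noRepeat)

  orbit-positive : ∀ N → InOrbit (embed m t) N → Positive N
  orbit-positive _ (ks , noRepeat , refl) =
    subst Positive (sym (applyWord-embed m ks t))
          (embed-positive (mutateWord m ks t) 4≤m (reduced-large ks noRepeat))

positive-inM : ∀ M → Positive M → x M * y M * z M ≡ x' M * y' M * z' M → InM M
positive-inM M (0<x , 0<y , 0<z , 0<x' , 0<y' , 0<z') xyz≡x'y'z' =
  xyz≡x'y'z' , inj₁ (0<x , 0<x') , inj₁ (0<y , 0<y') , inj₁ (0<z , 0<z')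

embed-xyz : ∀ m t → let M = embed m t in x M * y M * z M ≡ x' M * y' M * z' M
embed-xyz m (a , b , c) = identity m a b c
  where
  identity : ∀ m a b c → a * (m * b) * c ≡ m * a * b * c
  identity = solve-∀

SameSign-refl : ∀ i → SameSign i i
SameSign-refl i with <-cmp 0ℤ i
... | tri< 0<i _ _  = inj₁ (0<i , 0<i)
... | tri≈ _ refl _ = inj₂ (inj₁ (refl , refl))
... | tri> _ _ i<0  = inj₂ (inj₂ (i<0 , i<0))

InM⇒SkMarkov-CM : ∀ M → InM M → SkMarkov M (CM M)
InM⇒SkMarkov-CM M (xyz≡x'y'z' , _) = x M * y M * z M , square , SameSign-refl _ , refl
  where
  open ≡-Reasoning
  rearrange : ∀ x y z x' y' z' → x * y * z * (x' * y' * z') ≡ x * x' * (y * y') * (z * z')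
  rearrange = solve-∀
  square : (x M * y M * z M) * (x M * y M * z M) ≡ (x M * x' M) * (y M * y' M) * (z M * z' M)
  square = begin
    (x M * y M * z M) * (x M * y M * z M)    ≡⟨ cong (x M * y M * z M *_) xyz≡x'y'z' ⟩
    (x M * y M * z M) * (x' M * y' M * z' M) ≡⟨ rearrange (x M) (y M) (z M) (x' M) (y' M) (z' M) ⟩
    (x M * x' M) * (y M * y' M) * (z M * z' M) ∎

markovSeed : Triple
markovSeed = (+ 1 , + 1 , + 3)

markovWitness : ℤ → Arr
markovWitness c = embed (+ 9 - c) markovSeed

CM-markovWitness : ∀ c → CM (markovWitness c) ≡ c
CM-markovWitness c = identity c
  where
  identity : ∀ c → + 1 * ((+ 9 - c) * + 1) + (+ 9 - c) * + 1 * + 1 + + 3 * + 3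
                 - + 1 * ((+ 9 - c) * + 1) * + 3 ≡ c
  identity = solve-∀

-- The seed stays tallest at 2F after mutating at 2F, since c′ = m − 3 ≥ 2: this is where c ≤ 4
-- is needed.
markovWitness-clusterPositive : ∀ c → c ≤ + 4 → ClusterPositive (markovWitness c)
markovWitness-clusterPositive c c≤4 =
  embed-clusterPositive {k = 2F} markovSeed 4≤m large tallest large′ tallest′
  where
  m : ℤ
  m = + 9 - c
  0≤4-c : 0ℤ ≤ + 4 - c
  0≤4-c = i≤j⇒0≤j-i c≤4
  4≤m : + 4 ≤ m
  4≤m = ≤-by-certificate (identity c) (+-mono-≤ 0≤4-c (+≤+ z≤n))
    where
    identity : ∀ c → + 9 - c - + 4 ≡ + 4 - c + + 1
    identity = solve-∀
  2≤3 : + 2 ≤ + 3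
  2≤3 = +≤+ (ℕ.s≤s (ℕ.s≤s z≤n))
  2≤c′ : + 2 ≤ m * + 1 * + 1 - + 3
  2≤c′ = ≤-by-certificate (identity c) 0≤4-c
    where
    identity : ∀ c → (+ 9 - c) * + 1 * + 1 - + 3 - + 2 ≡ + 4 - c
    identity = solve-∀
  large : Large markovSeed
  large 0F = ≤-refl
  large 1F = ≤-refl
  large 2F = 2≤3
  tallest : Tallest 2F markovSeed
  tallest 0F = 2≤3
  tallest 1F = 2≤3
  tallest 2F = ≤-refl
  large′ : Large (mutate m 2F markovSeed)
  large′ 0F = ≤-refl
  large′ 1F = ≤-refl
  large′ 2F = 2≤c′
  tallest′ : Tallest 2F (mutate m 2F markovSeed)
  tallest′ 0F = 2≤c′
  tallest′ 1F = 2≤c′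
  tallest′ 2F = ≤-refl

markovWitness-∈MCPZ : ∀ c → c ≤ + 4 → InMCPZ (markovWitness c)
markovWitness-∈MCPZ c c≤4 =
  positive-inM (markovWitness c) (proj₁ cp) (embed-xyz (+ 9 - c) markovSeed) , cp
  where
  cp : ClusterPositive (markovWitness c)
  cp = markovWitness-clusterPositive c c≤4

theorem9p12 : ∀ (c : ℤ) → c ≤ + 4 →
    (∃ λ (M : Arr) → InMCPZ M × CM M ≡ c)
    × (∃ λ (M : Arr) → InMCPZ M × SkMarkov M c)
theorem9p12 c c≤4 =
  (M , M∈ , CM-markovWitness c) ,
  (M , M∈ , subst (SkMarkov M) (CM-markovWitness c) (InM⇒SkMarkov-CM M (proj₁ M∈)))
  where
  M : Arr
  M = markovWitness c
  M∈ : InMCPZ M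
  M∈ = markovWitness-∈MCPZ c c≤4
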